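{- Let $\mathbb{F}$ be a finite field with $q$ elements, and let $T$ be a nonempty subset of $\mathbb{F}^n$ with algebraic complexity $a(T)=r$. If $f\in\mathbb{F}[x_1,\dots,x_n]$ satisfies $\mathbb{F}^n\setminus T\subseteq\mathcal{Z}(f)$ and $T\cap\mathcal{Z}(f)=\emptyset$, then $\deg(f)+r\geq n(q-1)$.
   Context: For $f\in\mathbb{F}[x_1,\dots,x_n]$, $\mathcal{Z}(f)=\{a\in\mathbb{F}^n:f(a)=0\}$. Algebraic complexity: for a finite set $T\subseteq\mathbb{F}^n$ with $|T|>1$, $a(T)=\min\{\deg(g): g\in\mathbb{F}[x_1,\dots,x_n],\ |\mathcal{Z}(g)\cap T|=|T|-1\}$; if $|T|=1$, $a(T)=0$. -}

module Defs where

open import Level using (Level; _⊔_) renaming (suc to lsuc)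
open import Algebra.Bundles using (CommutativeRing)
open import Data.Nat as ℕ using (ℕ; zero; suc; _<_; _∸_)
open import Data.Fin using (Fin)
open import Data.List as List using (List; []; _∷_; length; filter; allFin; concatMap)
open import Data.Vec as Vec using (Vec; []; _∷_)
import Data.Vec.Properties as VecP
open import Data.Product using (Σ; ∃; _×_; _,_)
open import Relation.Nullary using (¬_; Dec; yes; no; _×-dec_)
open import Relation.Unary using (Pred)
open import Relation.Binary.Definitions using (Decidable)
open import Relation.Binary.PropositionalEquality using (_≡_)

record FiniteField (c ℓ : Level) : Set (lsuc (c ⊔ ℓ)) where
  field
    commRing : CommutativeRing c ℓ
  open CommutativeRing commRing public
  field
    0≉1     : ¬ (0# ≈ 1#)
    inverse : ∀ x → ¬ (x ≈ 0#) → ∃ λ y → (x * y) ≈ 1#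
    _≟_     : Decidable _≈_
    q       : ℕ
    enum    : Fin q → Carrier
    enum-injective  : ∀ i j → enum i ≈ enum j → i ≡ j
    enum-surjective : ∀ x → ∃ λ i → enum i ≈ x

module _ {c ℓ : Level} (F : FiniteField c ℓ) where
  open FiniteField F

  Point : ℕ → Set c
  Point n = Vec Carrier n

  _≈ᵥ_ : ∀ {n} → Point n → Point n → Set ℓ
  [] ≈ᵥ [] = Level.Lift _ Data.Unit.⊤ where import Data.Unit
  (x ∷ xs) ≈ᵥ (y ∷ ys) = (x ≈ y) × (xs ≈ᵥ ys)

  allPoints : (n : ℕ) → List (Point n)
  allPoints zero = [] ∷ []
  allPoints (suc n) =
    concatMap (λ i → List.map (enum i ∷_) (allPoints n)) (allFin q)

  count : ∀ {n p} {P : Pred (Point n) p} → Relation.Unary.Decidable P → ℕ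
  count {n} P? = length (filter P? (allPoints n))

  record Subset (n : ℕ) : Set (lsuc (c ⊔ ℓ)) where
    field
      _∈T    : Point n → Set (c ⊔ ℓ)
      ∈T?    : Relation.Unary.Decidable _∈T
      ∈T-resp : ∀ {x y} → x ≈ᵥ y → x ∈T → y ∈T

  ∣_∣ : ∀ {n} → Subset n → ℕ
  ∣ T ∣ = count (Subset.∈T? T)

  -- polynomials in F[x₁,…,xₙ], represented as formal finite sums of terms
  -- c · x^e (coefficient, exponent vector); two representations denote the
  -- same polynomial iff they have the same coefficients (see coeff).
  Poly : ℕ → Set c
  Poly n = List (Carrier × Vec ℕ n)

  pow : Carrier → ℕ → Carrier
  pow x zero = 1#
  pow x (suc k) = x * pow x k

  evalMono : ∀ {n} → Vec ℕ n → Point n → Carrier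
  evalMono [] [] = 1#
  evalMono (e ∷ es) (x ∷ xs) = pow x e * evalMono es xs

  eval : ∀ {n} → Poly n → Point n → Carrier
  eval [] x = 0#
  eval ((a , e) ∷ p) x = (a * evalMono e x) + eval p x

  coeff : ∀ {n} → Poly n → Vec ℕ n → Carrier
  coeff [] e = 0#
  coeff ((a , e′) ∷ p) e with VecP.≡-dec ℕ._≟_ e′ e
  ... | yes _ = a + coeff p e
  ... | no  _ = coeff p e

  totalDeg : ∀ {n} → Vec ℕ n → ℕ
  totalDeg = Vec.sum

  DegLe : ∀ {n} → Poly n → ℕ → Set ℓ
  DegLe f d = ∀ e → ¬ (coeff f e ≈ 0#) → totalDeg e ℕ.≤ d

  -- deg f = d (for the zero polynomial this gives 0; irrelevant below)
  HasDeg : ∀ {n} → Poly n → ℕ → Set ℓ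
  HasDeg f d = DegLe f d × (∀ d′ → DegLe f d′ → d ℕ.≤ d′)

  zerosIn : ∀ {n} → Subset n → Poly n → ℕ
  zerosIn T g = count (λ x → Subset.∈T? T x ×-dec (eval g x ≟ 0#))

  AlgComplexity : ∀ {n} → Subset n → ℕ → Set (c ⊔ ℓ)
  AlgComplexity T r =
    (∣ T ∣ ≡ 1 → r ≡ 0) ×
    (1 < ∣ T ∣ →
       (Σ (Poly _) λ g → (zerosIn T g ≡ ∣ T ∣ ∸ 1) × HasDeg g r) ×
       (∀ g d → zerosIn T g ≡ ∣ T ∣ ∸ 1 → HasDeg g d → r ℕ.≤ d))

{-# OPTIONS --safe #-}
-- Suppose d + r < n(q − 1). A polynomial g of degree ≤ r that is nonzero at exactly one point t₀
-- of T exists (g = 1 if |T| = 1, otherwise a witness of a(T) = r). Then f·g vanishes on Fⁿ except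
-- at t₀, so ∑_{x ∈ Fⁿ} f(x)g(x) = f(t₀)g(t₀) ≠ 0. But every monomial of f·g has total degree
-- < n(q − 1), hence some exponent k < q − 1, and ∑_{y ∈ F} yᵏ = 0 for k < q − 1 (for k = 0 this is
-- q·1 = 0; for k > 0 pick a with aᵏ ≠ 1, which exists because xᵏ − 1 has at most k roots, and
-- substitute y ↦ ay). So that sum vanishes, a contradiction.
module Submission where

open import Defs
open import Level using (Level)
open import Data.Nat as ℕ using (ℕ; zero; suc; _<_; _≤_; z≤n; s≤s; _<?_; _≤?_)
import Data.Nat.Properties as ℕ
open import Data.Fin as Fin using (Fin; punchIn; inject≤)
import Data.Fin.Properties as Fin
open import Data.Fin.Permutation using (Permutation; permutation)
open import Data.List as List using (List; []; _∷_; length; filter; _++_; concatMap; tabulate)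
open import Data.List.Properties using (filter-none; length-filter)
open import Data.List.Relation.Unary.All as All using (All; []; _∷_)
open import Data.List.Relation.Unary.All.Properties using (all-filter)
open import Data.List.Relation.Unary.Any using (here)
open import Data.List.Membership.Propositional using (_∈_; lose)
open import Data.List.Membership.Propositional.Properties
  using (∈-map⁺; ∈-concatMap⁺; ∈-allFin; ∈-filter⁺; ∈-length)
open import Data.Vec as Vec using (Vec; []; _∷_)
open import Data.Vec.Properties using (≡-dec)
open import Data.Product using (Σ; ∃; _×_; _,_; proj₁; proj₂)
open import Data.Sum using (inj₁; inj₂)
open import Data.Empty using (⊥-elim)
open import Data.Unit using (tt)
open import Function using (_∘_; id)
open import Function.Definitions using (Injective; Congruent)
open import Relation.Nullary using (¬_; yes; no; ¬?; _×-dec_)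
open import Relation.Unary using (Pred)
import Relation.Unary as U
open import Relation.Unary.Properties using (∁?)
open import Relation.Binary.PropositionalEquality as ≡ using (_≡_; _≢_)
open import Algebra.Properties.CommutativeSemigroup ℕ.+-commutativeSemigroup
  using (interchange)

m+n<o+p⇒o≤m⇒n<p : ∀ {m n o p} → m ℕ.+ n < o ℕ.+ p → o ≤ m → n < p
m+n<o+p⇒o≤m⇒n<p {_} {n} {o} {p} lt o≤m =
  ℕ.+-cancelˡ-< o n p (ℕ.≤-<-trans (ℕ.+-monoˡ-≤ n o≤m) lt)

sum-zipWith-+ : ∀ {n} (u v : Vec ℕ n) →
  Vec.sum (Vec.zipWith ℕ._+_ u v) ≡ Vec.sum u ℕ.+ Vec.sum v
sum-zipWith-+ [] [] = ≡.refl
sum-zipWith-+ (a ∷ u) (b ∷ v) =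
  ≡.trans (≡.cong (a ℕ.+ b ℕ.+_) (sum-zipWith-+ u v)) (interchange a b (Vec.sum u) (Vec.sum v))

sum-replicate-0 : ∀ n → Vec.sum (Vec.replicate n 0) ≡ 0
sum-replicate-0 zero = ≡.refl
sum-replicate-0 (suc n) = sum-replicate-0 n

injection-avoiding : ∀ {m k} (i : Fin m) → k ≤ m ℕ.∸ 1 →
  Σ (Fin k → Fin m) λ ρ → Injective _≡_ _≡_ ρ × (∀ j → ρ j ≢ i)
injection-avoiding {suc m} i k≤m =
  (λ j → punchIn i (inject≤ j k≤m)) ,
  (Fin.inject≤-injective k≤m k≤m _ _ ∘ Fin.punchIn-injective i _ _) ,
  (λ j → Fin.punchInᵢ≢i i _)

module _ {a p r} {A : Set a} {P : Pred A p} {R : Pred A r}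
         (P? : U.Decidable P) (R? : U.Decidable R) where

  length-filter-split : ∀ xs → length (filter P? xs) ≡
    length (filter (λ x → P? x ×-dec R? x) xs) ℕ.+ length (filter (λ x → P? x ×-dec ¬? (R? x)) xs)
  length-filter-split [] = ≡.refl
  length-filter-split (x ∷ xs) with P? x | R? x
  ... | yes _ | yes _ = ≡.cong suc (length-filter-split xs)
  ... | yes _ | no _ = ≡.trans (≡.cong suc (length-filter-split xs)) (≡.sym (ℕ.+-suc _ _))
  ... | no _ | _ = length-filter-split xs

module _ {c ℓ : Level} (F : FiniteField c ℓ) where
  open FiniteField F
  open import Relation.Binary.Reasoning.Setoid setoid
  open import Algebra.Properties.CommutativeMonoid.Sum +-commutativeMonoid
    using (sum; sum-cong-≋; sum-permute; ∑-distrib-+)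
  open import Algebra.Properties.Semiring.Sum semiring using (*-distribˡ-sum; *-distribʳ-sum)
  open import Algebra.Properties.CommutativeSemiring.Exp commutativeSemiring
    using (_^_; ^-congˡ; ^-homo-*; ^-distrib-*)
  open import Algebra.Properties.Ring ring using ([y-z]x≈yx-zx)
  open import Algebra.Properties.Group +-group
    using (identityʳ-unique; ∙-cancelˡ; //-rightDividesˡ; //-rightDividesʳ; x∙y⁻¹≈ε⇒x≈y; x≈y⇒x∙y⁻¹≈ε)
  open import Algebra.Properties.CommutativeSemigroup +-commutativeSemigroup using (x∙yz≈y∙xz)
  open import Algebra.Properties.CommutativeSemigroup *-commutativeSemigroup
    renaming (interchange to *-interchange) using ()
  open import Algebra.Solver.Ring.NaturalCoefficients.Default commutativeSemiring
    using (solve; _:+_; _:*_; _:=_)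

  x≉0⇒x*y≈0⇒y≈0 : ∀ {x y} → ¬ x ≈ 0# → x * y ≈ 0# → y ≈ 0#
  x≉0⇒x*y≈0⇒y≈0 {x} {y} x≉0 xy≈0 with inverse x x≉0
  ... | x⁻¹ , xx⁻¹≈1 = begin
    y              ≈⟨ *-identityˡ y ⟨
    1# * y         ≈⟨ *-congʳ (trans (*-comm x⁻¹ x) xx⁻¹≈1) ⟨
    (x⁻¹ * x) * y  ≈⟨ *-assoc x⁻¹ x y ⟩
    x⁻¹ * (x * y)  ≈⟨ *-congˡ xy≈0 ⟩
    x⁻¹ * 0#       ≈⟨ zeroʳ x⁻¹ ⟩
    0#             ∎

  x≉0⇒y≉0⇒x*y≉0 : ∀ {x y} → ¬ x ≈ 0# → ¬ y ≈ 0# → ¬ x * y ≈ 0#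
  x≉0⇒y≉0⇒x*y≉0 x≉0 y≉0 = y≉0 ∘ x≉0⇒x*y≈0⇒y≈0 x≉0

  x≉1⇒x*y≈y⇒y≈0 : ∀ {x y} → ¬ x ≈ 1# → x * y ≈ y → y ≈ 0#
  x≉1⇒x*y≈y⇒y≈0 {x} {y} x≉1 xy≈y = x≉0⇒x*y≈0⇒y≈0 (x≉1 ∘ x∙y⁻¹≈ε⇒x≈y x 1#) (begin
    (x - 1#) * y   ≈⟨ [y-z]x≈yx-zx y x 1# ⟩
    x * y - 1# * y ≈⟨ x≈y⇒x∙y⁻¹≈ε (trans xy≈y (sym (*-identityˡ y))) ⟩
    0#             ∎)

  enum⁻¹ : Carrier → Fin q
  enum⁻¹ x = proj₁ (enum-surjective x)

  enum∘enum⁻¹ : ∀ x → enum (enum⁻¹ x) ≈ x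
  enum∘enum⁻¹ x = proj₂ (enum-surjective x)

  sum-bijection : (σ σ⁻¹ : Carrier → Carrier) →
    Congruent _≈_ _≈_ σ → Congruent _≈_ _≈_ σ⁻¹ →
    (∀ x → σ (σ⁻¹ x) ≈ x) → (∀ x → σ⁻¹ (σ x) ≈ x) →
    (h : Carrier → Carrier) → Congruent _≈_ _≈_ h →
    sum (λ i → h (σ (enum i))) ≈ sum (λ i → h (enum i))
  sum-bijection σ σ⁻¹ σ-cong σ⁻¹-cong σσ⁻¹ σ⁻¹σ h h-cong = sym (begin
    sum (λ i → h (enum i))                     ≈⟨ sum-permute (h ∘ enum) π ⟩
    sum (λ i → h (enum (enum⁻¹ (σ (enum i))))) ≈⟨ sum-cong-≋ {q} (λ i → h-cong (enum∘enum⁻¹ _)) ⟩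
    sum (λ i → h (σ (enum i)))                 ∎)
    where
    π : Permutation q q
    π = permutation (λ i → enum⁻¹ (σ (enum i))) (λ i → enum⁻¹ (σ⁻¹ (enum i)))
      (λ i → enum-injective _ _ (trans (enum∘enum⁻¹ _) (trans (σ-cong (enum∘enum⁻¹ _)) (σσ⁻¹ _))))
      (λ i → enum-injective _ _ (trans (enum∘enum⁻¹ _) (trans (σ⁻¹-cong (enum∘enum⁻¹ _)) (σ⁻¹σ _))))

  -- Roots of univariate polynomials

  horner : List Carrier → Carrier → Carrier
  horner [] x = 0#
  horner (a ∷ p) x = a + x * horner p x

  horner-cong : ∀ p {x y} → x ≈ y → horner p x ≈ horner p y
  horner-cong [] x≈y = refl
  horner-cong (a ∷ p) x≈y = +-congˡ (*-cong x≈y (horner-cong p x≈y))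

  horner-zero : ∀ {p} → All (_≈ 0#) p → ∀ x → horner p x ≈ 0#
  horner-zero [] x = refl
  horner-zero (a≈0 ∷ p≈0) x =
    trans (+-cong a≈0 (trans (*-congˡ (horner-zero p≈0 x)) (zeroʳ x))) (+-identityʳ 0#)

  head≈horner : ∀ a {p} → All (_≈ 0#) p → ∀ x → a ≈ horner (a ∷ p) x
  head≈horner a p≈0 x =
    sym (trans (+-congˡ (trans (*-congˡ (horner-zero p≈0 x)) (zeroʳ x))) (+-identityʳ a))

  quotientAt : Carrier → List Carrier → List Carrier
  quotientAt a [] = []
  quotientAt a (b ∷ p) = horner (b ∷ p) a ∷ quotientAt a p

  length-quotientAt : ∀ a p → length (quotientAt a p) ≡ length p
  length-quotientAt a [] = ≡.refl
  length-quotientAt a (b ∷ p) = ≡.cong suc (length-quotientAt a p)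

  -- x·p(x) − a·p(a) = (x − a)·(quotientAt a p)(x), stated at x = y + a so that no subtraction occurs.
  x*horner-quotientAt : ∀ a p y →
    (y + a) * horner p (y + a) ≈ a * horner p a + y * horner (quotientAt a p) (y + a)
  x*horner-quotientAt a [] y = solve 3 (λ y a z → (y :+ a) :* z := a :* z :+ y :* z) refl y a 0#
  x*horner-quotientAt a (b ∷ p) y = begin
    x * (b + x * horner p x)       ≈⟨ *-congˡ (+-congˡ (x*horner-quotientAt a p y)) ⟩
    x * (b + (a * pa + y * Q))
      ≈⟨ solve 5 (λ y a b pa Q → (y :+ a) :* (b :+ (a :* pa :+ y :* Q))
                   := a :* (b :+ a :* pa) :+ y :* ((b :+ a :* pa) :+ (y :+ a) :* Q)) refl y a b pa Q ⟩
    a * (b + a * pa) + y * ((b + a * pa) + x * Q) ∎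
    where
    x = y + a
    pa = horner p a
    Q = horner (quotientAt a p) x

  quotientAt-zero : ∀ a p → All (_≈ 0#) (quotientAt a p) → All (_≈ 0#) p
  quotientAt-zero a [] _ = []
  quotientAt-zero a (b ∷ p) (pa≈0 ∷ Q≈0) = trans (head≈horner b p≈0 a) pa≈0 ∷ p≈0
    where
    p≈0 = quotientAt-zero a p Q≈0

  horner-root-bound : ∀ m p → length p ≤ m → (ρ : Fin m → Carrier) → Injective _≡_ _≈_ ρ →
    (∀ i → horner p (ρ i) ≈ 0#) → All (_≈ 0#) p
  horner-root-bound m [] _ _ _ _ = []
  horner-root-bound (suc m) (b ∷ p) (s≤s p≤m) ρ ρ-inj roots =
    trans (head≈horner b p≈0 a) (roots Fin.zero) ∷ p≈0
    where
    a = ρ Fin.zero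
    quotient-roots : ∀ i → horner (quotientAt a p) (ρ (Fin.suc i)) ≈ 0#
    quotient-roots i = trans (sym (horner-cong (quotientAt a p) (//-rightDividesˡ a x)))
      (x≉0⇒x*y≈0⇒y≈0 x-a≉0 (identityʳ-unique _ _ (begin
        a * horner p a + (x - a) * horner (quotientAt a p) (x - a + a)
          ≈⟨ x*horner-quotientAt a p (x - a) ⟨
        (x - a + a) * horner p (x - a + a)
          ≈⟨ *-cong (//-rightDividesˡ a x) (horner-cong p (//-rightDividesˡ a x)) ⟩
        x * horner p x
          ≈⟨ ∙-cancelˡ b _ _ (trans (roots (Fin.suc i)) (sym (roots Fin.zero))) ⟩
        a * horner p a ∎)))
      where
      x = ρ (Fin.suc i)
      x-a≉0 : ¬ x - a ≈ 0#
      x-a≉0 x-a≈0 with ρ-inj (x∙y⁻¹≈ε⇒x≈y x a x-a≈0)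
      ... | ()
    p≈0 : All (_≈ 0#) p
    p≈0 = quotientAt-zero a p (horner-root-bound m (quotientAt a p)
      (≡.subst (_≤ m) (≡.sym (length-quotientAt a p)) p≤m) (ρ ∘ Fin.suc)
      (Fin.suc-injective ∘ ρ-inj) quotient-roots)

  coefficientsOfPower : ℕ → List Carrier
  coefficientsOfPower zero = 1# ∷ []
  coefficientsOfPower (suc k) = 0# ∷ coefficientsOfPower k

  horner-coefficientsOfPower : ∀ k x → horner (coefficientsOfPower k) x ≈ x ^ k
  horner-coefficientsOfPower zero x = trans (+-congˡ (zeroʳ x)) (+-identityʳ 1#)
  horner-coefficientsOfPower (suc k) x =
    trans (+-identityˡ _) (*-congˡ (horner-coefficientsOfPower k x))

  length-coefficientsOfPower : ∀ k → length (coefficientsOfPower k) ≡ suc k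
  length-coefficientsOfPower zero = ≡.refl
  length-coefficientsOfPower (suc k) = ≡.cong suc (length-coefficientsOfPower k)

  coefficientsOfPower≉0 : ∀ k → ¬ All (_≈ 0#) (coefficientsOfPower k)
  coefficientsOfPower≉0 zero (1≈0 ∷ _) = 0≉1 (sym 1≈0)
  coefficientsOfPower≉0 (suc k) (_ ∷ cs≈0) = coefficientsOfPower≉0 k cs≈0

  -- xᵏ − 1 has k + 1 coefficients, so it cannot vanish on k + 1 distinct nonzero elements.
  ∃x≉0∧x^k≉1 : ∀ k → 0 < k → k < q ℕ.∸ 1 → ∃ λ x → ¬ x ≈ 0# × ¬ x ^ k ≈ 1#
  ∃x≉0∧x^k≉1 (suc k) _ k<q-1 with injection-avoiding (enum⁻¹ 0#) k<q-1
  ... | ρ , ρ-inj , ρ≢0 = x , x≉0 , x^k≉1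
    where
    xᵏ-1 : List Carrier
    xᵏ-1 = (- 1#) ∷ coefficientsOfPower k
    horner-xᵏ-1 : ∀ x → x ^ suc k ≈ 1# → horner xᵏ-1 x ≈ 0#
    horner-xᵏ-1 x x^k≈1 = begin
      - 1# + x * horner (coefficientsOfPower k) x ≈⟨ +-congˡ (*-congˡ (horner-coefficientsOfPower k x)) ⟩
      - 1# + x ^ suc k                            ≈⟨ +-congˡ x^k≈1 ⟩
      - 1# + 1#                                   ≈⟨ -‿inverseˡ 1# ⟩
      0#                                          ∎
    not-all-roots : ¬ (∀ j → horner xᵏ-1 (enum (ρ j)) ≈ 0#)
    not-all-roots all-roots with horner-root-bound (suc (suc k)) xᵏ-1
      (ℕ.≤-reflexive (≡.cong suc (length-coefficientsOfPower k))) (enum ∘ ρ)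
      (ρ-inj ∘ enum-injective _ _) all-roots
    ... | _ ∷ cs≈0 = coefficientsOfPower≉0 k cs≈0
    non-root = Fin.¬∀⟶∃¬ _ _ (λ j → horner xᵏ-1 (enum (ρ j)) ≟ 0#) not-all-roots
    x = enum (ρ (proj₁ non-root))
    x≉0 : ¬ x ≈ 0#
    x≉0 x≈0 = ρ≢0 (proj₁ non-root) (enum-injective _ _ (trans x≈0 (sym (enum∘enum⁻¹ 0#))))
    x^k≉1 : ¬ x ^ suc k ≈ 1#
    x^k≉1 = proj₂ non-root ∘ horner-xᵏ-1 x

  -- Power sums over F

  powerSum : ℕ → Carrier
  powerSum k = sum (λ i → enum i ^ k)

  -- the translation y ↦ y + 1 permutes F, so ∑ y = ∑ (y + 1) = ∑ y + q·1
  powerSum-zero : powerSum 0 ≈ 0#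
  powerSum-zero = identityʳ-unique _ _ (begin
    sum enum + sum {q} (λ _ → 1#) ≈⟨ ∑-distrib-+ enum (λ _ → 1#) ⟨
    sum (λ i → enum i + 1#)       ≈⟨ sum-bijection (_+ 1#) (_- 1#) +-congʳ +-congʳ
                                       (//-rightDividesˡ 1#) (//-rightDividesʳ 1#) id id ⟩
    sum enum                      ∎)

  -- for aᵏ ≠ 1 the dilation y ↦ a·y permutes F, so aᵏ·∑ yᵏ = ∑ yᵏ
  powerSum-suc : ∀ k → suc k < q ℕ.∸ 1 → powerSum (suc k) ≈ 0#
  powerSum-suc k k<q-1 with ∃x≉0∧x^k≉1 (suc k) (s≤s z≤n) k<q-1
  ... | a , a≉0 , a^k≉1 with inverse a a≉0
  ... | a⁻¹ , aa⁻¹≈1 = x≉1⇒x*y≈y⇒y≈0 a^k≉1 (begin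
    a ^ suc k * powerSum (suc k)
      ≈⟨ *-distribˡ-sum (a ^ suc k) (λ i → enum i ^ suc k) ⟩
    sum (λ i → a ^ suc k * enum i ^ suc k)
      ≈⟨ sum-cong-≋ {q} (λ i → ^-distrib-* a (enum i) (suc k)) ⟨
    sum (λ i → (a * enum i) ^ suc k)
      ≈⟨ sum-bijection (a *_) (a⁻¹ *_) *-congˡ *-congˡ
           (cancel a a⁻¹ aa⁻¹≈1) (cancel a⁻¹ a (trans (*-comm a⁻¹ a) aa⁻¹≈1))
           (_^ suc k) (^-congˡ (suc k)) ⟩
    powerSum (suc k) ∎)
    where
    cancel : ∀ b c → b * c ≈ 1# → ∀ x → b * (c * x) ≈ x
    cancel b c bc≈1 x = trans (sym (*-assoc b c x)) (trans (*-congʳ bc≈1) (*-identityˡ x))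

  powerSum≈0 : ∀ k → k < q ℕ.∸ 1 → powerSum k ≈ 0#
  powerSum≈0 zero _ = powerSum-zero
  powerSum≈0 (suc k) k<q-1 = powerSum-suc k k<q-1

  -- Sums over Fⁿ

  ∑ⁿ : ∀ n → (Point F n → Carrier) → Carrier
  ∑ⁿ zero φ = φ []
  ∑ⁿ (suc n) φ = sum (λ i → ∑ⁿ n (λ xs → φ (enum i ∷ xs)))

  ∑ⁿ-cong : ∀ n {φ ψ : Point F n → Carrier} → (∀ x → φ x ≈ ψ x) → ∑ⁿ n φ ≈ ∑ⁿ n ψ
  ∑ⁿ-cong zero φ≈ψ = φ≈ψ []
  ∑ⁿ-cong (suc n) φ≈ψ = sum-cong-≋ {q} (λ i → ∑ⁿ-cong n (λ xs → φ≈ψ (enum i ∷ xs)))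

  ∑ⁿ-distrib-+ : ∀ n (φ ψ : Point F n → Carrier) → ∑ⁿ n (λ x → φ x + ψ x) ≈ ∑ⁿ n φ + ∑ⁿ n ψ
  ∑ⁿ-distrib-+ zero φ ψ = refl
  ∑ⁿ-distrib-+ (suc n) φ ψ = begin
    sum (λ i → ∑ⁿ n (λ xs → φ (enum i ∷ xs) + ψ (enum i ∷ xs)))
      ≈⟨ sum-cong-≋ {q} (λ i → ∑ⁿ-distrib-+ n (φ ∘ (enum i ∷_)) (ψ ∘ (enum i ∷_))) ⟩
    sum (λ i → ∑ⁿ n (φ ∘ (enum i ∷_)) + ∑ⁿ n (ψ ∘ (enum i ∷_)))
      ≈⟨ ∑-distrib-+ (λ i → ∑ⁿ n (φ ∘ (enum i ∷_))) (λ i → ∑ⁿ n (ψ ∘ (enum i ∷_))) ⟩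
    ∑ⁿ (suc n) φ + ∑ⁿ (suc n) ψ ∎

  ∑ⁿ-distribˡ-* : ∀ n a (φ : Point F n → Carrier) → ∑ⁿ n (λ x → a * φ x) ≈ a * ∑ⁿ n φ
  ∑ⁿ-distribˡ-* zero a φ = refl
  ∑ⁿ-distribˡ-* (suc n) a φ = begin
    sum (λ i → ∑ⁿ n (λ xs → a * φ (enum i ∷ xs))) ≈⟨ sum-cong-≋ {q} (λ i → ∑ⁿ-distribˡ-* n a (φ ∘ (enum i ∷_))) ⟩
    sum (λ i → a * ∑ⁿ n (φ ∘ (enum i ∷_)))       ≈⟨ *-distribˡ-sum a (λ i → ∑ⁿ n (φ ∘ (enum i ∷_))) ⟨
    a * ∑ⁿ (suc n) φ                              ∎

  ∑ˡ : ∀ {n} → List (Point F n) → (Point F n → Carrier) → Carrier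
  ∑ˡ [] φ = 0#
  ∑ˡ (x ∷ xs) φ = φ x + ∑ˡ xs φ

  ∑ˡ-++ : ∀ {n} (xs ys : List (Point F n)) φ → ∑ˡ (xs ++ ys) φ ≈ ∑ˡ xs φ + ∑ˡ ys φ
  ∑ˡ-++ [] ys φ = sym (+-identityˡ _)
  ∑ˡ-++ (x ∷ xs) ys φ = trans (+-congˡ (∑ˡ-++ xs ys φ)) (sym (+-assoc _ _ _))

  ∑ˡ-map : ∀ {m n} (h : Point F m → Point F n) xs φ → ∑ˡ (List.map h xs) φ ≡ ∑ˡ xs (φ ∘ h)
  ∑ˡ-map h [] φ = ≡.refl
  ∑ˡ-map h (x ∷ xs) φ = ≡.cong (φ (h x) +_) (∑ˡ-map h xs φ)

  ∑ˡ-concatMap-tabulate : ∀ {n} m (g : Fin q → List (Point F n)) (h : Fin m → Fin q) φ →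
    ∑ˡ (concatMap g (tabulate h)) φ ≈ sum (λ i → ∑ˡ (g (h i)) φ)
  ∑ˡ-concatMap-tabulate zero g h φ = refl
  ∑ˡ-concatMap-tabulate (suc m) g h φ =
    trans (∑ˡ-++ (g (h Fin.zero)) _ φ) (+-congˡ (∑ˡ-concatMap-tabulate m g (h ∘ Fin.suc) φ))

  ∑ⁿ≈∑ˡ-allPoints : ∀ n φ → ∑ⁿ n φ ≈ ∑ˡ (allPoints F n) φ
  ∑ⁿ≈∑ˡ-allPoints zero φ = sym (+-identityʳ _)
  ∑ⁿ≈∑ˡ-allPoints (suc n) φ = sym (begin
    ∑ˡ (allPoints F (suc n)) φ
      ≈⟨ ∑ˡ-concatMap-tabulate q (λ i → List.map (enum i ∷_) (allPoints F n)) id φ ⟩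
    sum (λ i → ∑ˡ (List.map (enum i ∷_) (allPoints F n)) φ)
      ≈⟨ sum-cong-≋ {q} (λ i → trans (reflexive (∑ˡ-map (enum i ∷_) (allPoints F n) φ))
                                     (sym (∑ⁿ≈∑ˡ-allPoints n (φ ∘ (enum i ∷_))))) ⟩
    ∑ⁿ (suc n) φ ∎)

  ∑ˡ-filter : ∀ {n p} {P : Pred (Point F n) p} (P? : U.Decidable P) φ → (∀ x → ¬ P x → φ x ≈ 0#) →
    ∀ xs → ∑ˡ xs φ ≈ ∑ˡ (filter P? xs) φ
  ∑ˡ-filter P? φ φ≈0 [] = refl
  ∑ˡ-filter P? φ φ≈0 (x ∷ xs) with P? x
  ... | yes _ = +-congˡ (∑ˡ-filter P? φ φ≈0 xs)
  ... | no ¬Px = trans (+-cong (φ≈0 x ¬Px) (∑ˡ-filter P? φ φ≈0 xs)) (+-identityˡ _)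

  allPoints-complete : ∀ n (x : Point F n) → ∃ λ y → y ∈ allPoints F n × _≈ᵥ_ F x y
  allPoints-complete zero [] = [] , here ≡.refl , Level.lift tt
  allPoints-complete (suc n) (a ∷ x) with allPoints-complete n x
  ... | y , y∈ , x≈y =
    enum (enum⁻¹ a) ∷ y ,
    ∈-concatMap⁺ (λ i → List.map (enum i ∷_) (allPoints F n))
      (lose (∈-allFin (enum⁻¹ a)) (∈-map⁺ (enum (enum⁻¹ a) ∷_) y∈)) ,
    (sym (enum∘enum⁻¹ a) , x≈y)

  ∑ⁿ-concentrated : ∀ n {p} {P : Pred (Point F n) p} (P? : U.Decidable P) (φ : Point F n → Carrier) →
    (∀ x → ¬ P x → φ x ≈ 0#) → count F P? ≡ 1 → ∃ λ y → P y × ∑ⁿ n φ ≈ φ y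
  ∑ⁿ-concentrated n {P = P} P? φ φ≈0 count≡1 =
    singleton count≡1 (all-filter P? (allPoints F n))
      (trans (∑ⁿ≈∑ˡ-allPoints n φ) (∑ˡ-filter P? φ φ≈0 (allPoints F n)))
    where
    singleton : ∀ {ys} → length ys ≡ 1 → All P ys → ∑ⁿ n φ ≈ ∑ˡ ys φ → ∃ λ y → P y × ∑ⁿ n φ ≈ φ y
    singleton {y ∷ []} _ (Py ∷ []) ∑≈ = y , Py , trans ∑≈ (+-identityʳ _)

  pow≈^ : ∀ x k → pow F x k ≈ x ^ k
  pow≈^ x zero = refl
  pow≈^ x (suc k) = *-congˡ (pow≈^ x k)

  ∑ⁿ-evalMono-∷ : ∀ n k (e : Vec ℕ n) →
    ∑ⁿ (suc n) (evalMono F (k ∷ e)) ≈ powerSum k * ∑ⁿ n (evalMono F e)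
  ∑ⁿ-evalMono-∷ n k e = begin
    sum (λ i → ∑ⁿ n (λ xs → pow F (enum i) k * evalMono F e xs))
      ≈⟨ sum-cong-≋ {q} (λ i → ∑ⁿ-distribˡ-* n (pow F (enum i) k) (evalMono F e)) ⟩
    sum (λ i → pow F (enum i) k * ∑ⁿ n (evalMono F e))
      ≈⟨ sum-cong-≋ {q} (λ i → *-congʳ (pow≈^ (enum i) k)) ⟩
    sum (λ i → enum i ^ k * ∑ⁿ n (evalMono F e))
      ≈⟨ *-distribʳ-sum (∑ⁿ n (evalMono F e)) (λ i → enum i ^ k) ⟨
    powerSum k * ∑ⁿ n (evalMono F e) ∎

  -- some exponent of a monomial of total degree < n(q − 1) is < q − 1
  ∑ⁿ-evalMono≈0 : ∀ n (e : Vec ℕ n) → totalDeg F e < n ℕ.* (q ℕ.∸ 1) → ∑ⁿ n (evalMono F e) ≈ 0#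
  ∑ⁿ-evalMono≈0 (suc n) (k ∷ e) deg< with k <? q ℕ.∸ 1
  ... | yes k<q-1 = trans (∑ⁿ-evalMono-∷ n k e) (trans (*-congʳ (powerSum≈0 k k<q-1)) (zeroˡ _))
  ... | no k≮q-1 = trans (∑ⁿ-evalMono-∷ n k e)
    (trans (*-congˡ (∑ⁿ-evalMono≈0 n e (m+n<o+p⇒o≤m⇒n<p deg< (ℕ.≮⇒≥ k≮q-1)))) (zeroʳ _))

  evalMono-zipWith-+ : ∀ {n} (e e′ : Vec ℕ n) x →
    evalMono F (Vec.zipWith ℕ._+_ e e′) x ≈ evalMono F e x * evalMono F e′ x
  evalMono-zipWith-+ [] [] [] = sym (*-identityˡ 1#)
  evalMono-zipWith-+ (k ∷ e) (k′ ∷ e′) (y ∷ x) = begin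
    pow F y (k ℕ.+ k′) * evalMono F (Vec.zipWith ℕ._+_ e e′) x
      ≈⟨ *-cong (trans (pow≈^ y (k ℕ.+ k′)) (^-homo-* y k k′)) (evalMono-zipWith-+ e e′ x) ⟩
    (y ^ k * y ^ k′) * (evalMono F e x * evalMono F e′ x)
      ≈⟨ *-interchange (y ^ k) (y ^ k′) (evalMono F e x) (evalMono F e′ x) ⟩
    (y ^ k * evalMono F e x) * (y ^ k′ * evalMono F e′ x)
      ≈⟨ *-cong (*-congʳ (pow≈^ y k)) (*-congʳ (pow≈^ y k′)) ⟨
    (pow F y k * evalMono F e x) * (pow F y k′ * evalMono F e′ x) ∎

  restrict : ∀ {n p} {Q : Pred (Vec ℕ n) p} → U.Decidable Q → Poly F n → Poly F n
  restrict Q? = filter (Q? ∘ proj₂)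

  eval-restrict-split : ∀ {n p} {Q : Pred (Vec ℕ n) p} (Q? : U.Decidable Q) (f : Poly F n) x →
    eval F f x ≈ eval F (restrict Q? f) x + eval F (restrict (∁? Q?) f) x
  eval-restrict-split Q? [] x = sym (+-identityˡ 0#)
  eval-restrict-split Q? ((a , e) ∷ f) x with Q? e
  ... | yes _ = trans (+-congˡ (eval-restrict-split Q? f x)) (sym (+-assoc _ _ _))
  ... | no _ = trans (+-congˡ (eval-restrict-split Q? f x)) (x∙yz≈y∙xz _ _ _)

  coeff-∷-≡ : ∀ {n} a e (f : Poly F n) → coeff F ((a , e) ∷ f) e ≈ a + coeff F f e
  coeff-∷-≡ a e f with ≡-dec ℕ._≟_ e e
  ... | yes _ = refl
  ... | no e≢e = ⊥-elim (e≢e ≡.refl)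

  coeff-∷-≢ : ∀ {n} a {e e′} (f : Poly F n) → e ≢ e′ → coeff F ((a , e) ∷ f) e′ ≈ coeff F f e′
  coeff-∷-≢ a {e} {e′} f e≢e′ with ≡-dec ℕ._≟_ e e′
  ... | yes e≡e′ = ⊥-elim (e≢e′ e≡e′)
  ... | no _ = refl

  module _ {n p} {Q : Pred (Vec ℕ n) p} (Q? : U.Decidable Q) where

    coeff-restrict-∈ : ∀ (f : Poly F n) {e} → Q e → coeff F (restrict Q? f) e ≈ coeff F f e
    coeff-restrict-∈ [] _ = refl
    coeff-restrict-∈ ((a , e′) ∷ f) {e} Qe with Q? e′
    ... | yes _ with ≡-dec ℕ._≟_ e′ e
    ...   | yes _ = +-congˡ (coeff-restrict-∈ f Qe)
    ...   | no _ = coeff-restrict-∈ f Qe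
    coeff-restrict-∈ ((a , e′) ∷ f) {e} Qe | no ¬Qe′ with ≡-dec ℕ._≟_ e′ e
    ...   | yes ≡.refl = ⊥-elim (¬Qe′ Qe)
    ...   | no _ = coeff-restrict-∈ f Qe

    coeff-restrict-∉ : ∀ (f : Poly F n) {e} → ¬ Q e → coeff F (restrict Q? f) e ≈ 0#
    coeff-restrict-∉ [] _ = refl
    coeff-restrict-∉ ((a , e′) ∷ f) {e} ¬Qe with Q? e′
    ... | no _ = coeff-restrict-∉ f ¬Qe
    ... | yes Qe′ with ≡-dec ℕ._≟_ e′ e
    ...   | yes ≡.refl = ⊥-elim (¬Qe Qe′)
    ...   | no _ = coeff-restrict-∉ f ¬Qe

  eval-restrict-≡ : ∀ {n} (f : Poly F n) e x →
    eval F (restrict (λ e′ → ≡-dec ℕ._≟_ e′ e) f) x ≈ coeff F f e * evalMono F e x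
  eval-restrict-≡ [] e x = sym (zeroˡ _)
  eval-restrict-≡ ((a , e′) ∷ f) e x with ≡-dec ℕ._≟_ e′ e
  ... | yes ≡.refl = trans (+-congˡ (eval-restrict-≡ f e x)) (sym (distribʳ _ _ _))
  ... | no _ = eval-restrict-≡ f e x

  -- induction on the number of terms: split off all terms sharing the first term's exponent
  coeff≈0⇒eval≈0 : ∀ {n} (f : Poly F n) → (∀ e → coeff F f e ≈ 0#) → ∀ x → eval F f x ≈ 0#
  coeff≈0⇒eval≈0 f = go (length f) f ℕ.≤-refl
    where
    go : ∀ {n} terms (f : Poly F n) → length f ≤ terms → (∀ e → coeff F f e ≈ 0#) → ∀ x → eval F f x ≈ 0#
    go _ [] _ _ x = refl
    go (suc terms) ((a , e) ∷ f) (s≤s f≤terms) coeff≈0 x = begin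
      a * evalMono F e x + eval F f x
        ≈⟨ +-congˡ (eval-restrict-split ≡e? f x) ⟩
      a * evalMono F e x + (eval F (restrict ≡e? f) x + eval F rest x)
        ≈⟨ +-congˡ (+-cong (eval-restrict-≡ f e x) rest≈0) ⟩
      a * evalMono F e x + (coeff F f e * evalMono F e x + 0#)
        ≈⟨ +-congˡ (+-identityʳ _) ⟩
      a * evalMono F e x + coeff F f e * evalMono F e x
        ≈⟨ distribʳ (evalMono F e x) a (coeff F f e) ⟨
      (a + coeff F f e) * evalMono F e x
        ≈⟨ *-congʳ (trans (sym (coeff-∷-≡ a e f)) (coeff≈0 e)) ⟩
      0# * evalMono F e x
        ≈⟨ zeroˡ _ ⟩
      0# ∎
      where
      ≡e? : U.Decidable (_≡ e)
      ≡e? e′ = ≡-dec ℕ._≟_ e′ e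
      rest = restrict (∁? ≡e?) f
      coeff-rest≈0 : ∀ e′ → coeff F rest e′ ≈ 0#
      coeff-rest≈0 e′ with ≡-dec ℕ._≟_ e′ e
      ... | yes e′≡e = coeff-restrict-∉ (∁? ≡e?) f (λ e′≢e → e′≢e e′≡e)
      ... | no e′≢e = trans (coeff-restrict-∈ (∁? ≡e?) f e′≢e)
        (trans (sym (coeff-∷-≢ a f (e′≢e ∘ ≡.sym))) (coeff≈0 e′))
      rest≈0 = go terms rest (ℕ.≤-trans (length-filter _ f) f≤terms) coeff-rest≈0 x

  -- A Poly may list terms of degree > d whose coefficients cancel; DegLe ignores them, truncation drops them.
  truncate : ∀ {n} → ℕ → Poly F n → Poly F n
  truncate d = restrict (λ e → totalDeg F e ≤? d)

  eval-truncate : ∀ {n} (f : Poly F n) d → DegLe F f d → ∀ x → eval F f x ≈ eval F (truncate d f) x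
  eval-truncate f d f≤d x = begin
    eval F f x                                  ≈⟨ eval-restrict-split deg≤d? f x ⟩
    eval F (truncate d f) x + eval F high x     ≈⟨ +-congˡ (coeff≈0⇒eval≈0 high coeff-high≈0 x) ⟩
    eval F (truncate d f) x + 0#                ≈⟨ +-identityʳ _ ⟩
    eval F (truncate d f) x                     ∎
    where
    deg≤d? : U.Decidable (λ e → totalDeg F e ≤ d)
    deg≤d? e = totalDeg F e ≤? d
    high = restrict (∁? deg≤d?) f
    coeff-high≈0 : ∀ e → coeff F high e ≈ 0#
    coeff-high≈0 e with totalDeg F e ≤? d
    ... | yes deg≤d = coeff-restrict-∉ (∁? deg≤d?) f (λ deg≰d → deg≰d deg≤d)
    ... | no deg≰d with coeff F f e ≟ 0#
    ...   | yes coeff≈0 = trans (coeff-restrict-∈ (∁? deg≤d?) f deg≰d) coeff≈0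
    ...   | no coeff≉0 = ⊥-elim (deg≰d (f≤d e coeff≉0))

  ∑ⁿ-eval*≈0 : ∀ n (f : Poly F n) (G : Point F n → Carrier) →
    All (λ (_ , e) → ∑ⁿ n (λ x → evalMono F e x * G x) ≈ 0#) f →
    ∑ⁿ n (λ x → eval F f x * G x) ≈ 0#
  ∑ⁿ-eval*≈0 n [] G [] = trans (∑ⁿ-distribˡ-* n 0# G) (zeroˡ _)
  ∑ⁿ-eval*≈0 n ((a , e) ∷ f) G (∑eG≈0 ∷ ∑fG≈0) = begin
    ∑ⁿ n (λ x → (a * evalMono F e x + eval F f x) * G x)
      ≈⟨ ∑ⁿ-cong n (λ x → solve 4 (λ a m v g → (a :* m :+ v) :* g := a :* (m :* g) :+ v :* g)
                            refl a (evalMono F e x) (eval F f x) (G x)) ⟩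
    ∑ⁿ n (λ x → a * (evalMono F e x * G x) + eval F f x * G x)
      ≈⟨ ∑ⁿ-distrib-+ n (λ x → a * (evalMono F e x * G x)) (λ x → eval F f x * G x) ⟩
    ∑ⁿ n (λ x → a * (evalMono F e x * G x)) + ∑ⁿ n (λ x → eval F f x * G x)
      ≈⟨ +-cong (trans (∑ⁿ-distribˡ-* n a _) (trans (*-congˡ ∑eG≈0) (zeroʳ a))) (∑ⁿ-eval*≈0 n f G ∑fG≈0) ⟩
    0# + 0#
      ≈⟨ +-identityʳ 0# ⟩
    0# ∎

  ∑ⁿ-eval*eval≈0 : ∀ n (f g : Poly F n) d r → DegLe F f d → DegLe F g r →
    d ℕ.+ r < n ℕ.* (q ℕ.∸ 1) → ∑ⁿ n (λ x → eval F f x * eval F g x) ≈ 0#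
  ∑ⁿ-eval*eval≈0 n f g d r f≤d g≤r d+r< =
    trans (∑ⁿ-cong n (λ x → *-cong (eval-truncate f d f≤d x) (eval-truncate g r g≤r x)))
      (∑ⁿ-eval*≈0 n (truncate d f) (eval F (truncate r g))
        (All.map (λ {t} → ∑eg≈0 (proj₂ t)) (all-filter (λ (_ , e) → totalDeg F e ≤? d) f)))
    where
    ∑e′e≈0 : ∀ e e′ → totalDeg F e ≤ d → totalDeg F e′ ≤ r →
      ∑ⁿ n (λ x → evalMono F e′ x * evalMono F e x) ≈ 0#
    ∑e′e≈0 e e′ e≤d e′≤r = trans (∑ⁿ-cong n (λ x → sym (evalMono-zipWith-+ e′ e x)))
      (∑ⁿ-evalMono≈0 n (Vec.zipWith ℕ._+_ e′ e)
        (ℕ.≤-<-trans (ℕ.≤-trans (ℕ.≤-reflexive (sum-zipWith-+ e′ e)) (ℕ.+-mono-≤ e′≤r e≤d))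
          (≡.subst (_< n ℕ.* (q ℕ.∸ 1)) (ℕ.+-comm d r) d+r<)))
    ∑eg≈0 : ∀ e → totalDeg F e ≤ d → ∑ⁿ n (λ x → evalMono F e x * eval F (truncate r g) x) ≈ 0#
    ∑eg≈0 e e≤d =
      trans (∑ⁿ-cong n (λ x → *-comm (evalMono F e x) _))
        (∑ⁿ-eval*≈0 n (truncate r g) (evalMono F e)
          (All.map (λ {t} → ∑e′e≈0 e (proj₂ t) e≤d) (all-filter (λ (_ , e′) → totalDeg F e′ ≤? r) g)))

  one : ∀ n → Poly F n
  one n = (1# , Vec.replicate n 0) ∷ []

  evalMono-replicate-0 : ∀ n x → evalMono F (Vec.replicate n 0) x ≈ 1#
  evalMono-replicate-0 zero [] = refl
  evalMono-replicate-0 (suc n) (_ ∷ x) = trans (*-identityˡ _) (evalMono-replicate-0 n x)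

  eval-one : ∀ n x → eval F (one n) x ≈ 1#
  eval-one n x = trans (+-identityʳ _) (trans (*-identityˡ _) (evalMono-replicate-0 n x))

  one-DegLe-0 : ∀ n → DegLe F (one n) 0
  one-DegLe-0 n e coeff≉0 with ≡-dec ℕ._≟_ (Vec.replicate n 0) e
  ... | yes ≡.refl = ℕ.≤-reflexive (sum-replicate-0 n)
  ... | no _ = ⊥-elim (coeff≉0 refl)

  -- A polynomial nonzero at exactly one point of T

  module _ {n} (T : Subset F n) where
    open Subset T

    ∣T∣ : ℕ
    ∣T∣ = ∣_∣ F T

    nonzeroIn : Poly F n → ℕ
    nonzeroIn g = count F (λ x → ∈T? x ×-dec ¬? (eval F g x ≟ 0#))

    nonzeroIn≡∣T∣∸zerosIn : ∀ g → nonzeroIn g ≡ ∣T∣ ℕ.∸ zerosIn F T g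
    nonzeroIn≡∣T∣∸zerosIn g = ≡.trans (≡.sym (ℕ.m+n∸m≡n (zerosIn F T g) (nonzeroIn g)))
      (≡.cong (ℕ._∸ zerosIn F T g) (≡.sym (length-filter-split ∈T? (λ x → eval F g x ≟ 0#) (allPoints F n))))

    ∣T∣>0 : ∃ (λ t → t ∈T) → 0 < ∣T∣
    ∣T∣>0 (t , t∈T) with allPoints-complete n t
    ... | y , y∈ , t≈y = ∈-length (∈-filter⁺ ∈T? y∈ (∈T-resp t≈y t∈T))

    ∃-nonzeroIn≡1 : ∀ {r} → ∃ (λ t → t ∈T) → AlgComplexity F T r →
      Σ (Poly F n) λ g → DegLe F g r × nonzeroIn g ≡ 1
    ∃-nonzeroIn≡1 T≢∅ (∣T∣≡1⇒r≡0 , ∣T∣>1⇒witness) with ℕ.m≤n⇒m<n∨m≡n (∣T∣>0 T≢∅)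
    ... | inj₂ 1≡∣T∣ =
      one n ,
      ≡.subst (DegLe F (one n)) (≡.sym (∣T∣≡1⇒r≡0 (≡.sym 1≡∣T∣))) (one-DegLe-0 n) ,
      ≡.trans (nonzeroIn≡∣T∣∸zerosIn (one n))
        (≡.trans (≡.cong (ℕ._∸_ ∣T∣) zerosIn-one≡0) (≡.sym 1≡∣T∣))
      where
      zerosIn-one≡0 : zerosIn F T (one n) ≡ 0
      zerosIn-one≡0 = ≡.cong length (filter-none _
        (All.universal (λ x (_ , one≈0) → 0≉1 (trans (sym one≈0) (eval-one n x))) (allPoints F n)))
    ... | inj₁ ∣T∣>1 with ∣T∣>1⇒witness ∣T∣>1
    ...   | (g , zerosIn≡∣T∣∸1 , (g≤r , _)) , _ =
      g , g≤r ,
      ≡.trans (nonzeroIn≡∣T∣∸zerosIn g)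
        (≡.trans (≡.cong (ℕ._∸_ ∣T∣) zerosIn≡∣T∣∸1) (ℕ.m∸[m∸n]≡n (∣T∣>0 T≢∅)))

    ∑ⁿ-eval*eval≉0 : (f g : Poly F n) →
      (∀ x → ¬ x ∈T → eval F f x ≈ 0#) → (∀ x → x ∈T → ¬ eval F f x ≈ 0#) → nonzeroIn g ≡ 1 →
      ¬ ∑ⁿ n (λ x → eval F f x * eval F g x) ≈ 0#
    ∑ⁿ-eval*eval≉0 f g f≈0-off-T f≉0-on-T nonzeroIn≡1 ∑≈0 =
      let y , (y∈T , gy≉0) , ∑≈fygy = ∑ⁿ-concentrated n (λ x → ∈T? x ×-dec ¬? (eval F g x ≟ 0#)) _
                                        fg≈0 nonzeroIn≡1
      in x≉0⇒y≉0⇒x*y≉0 (f≉0-on-T y y∈T) gy≉0 (trans (sym ∑≈fygy) ∑≈0)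
      where
      fg≈0 : ∀ x → ¬ (x ∈T × ¬ eval F g x ≈ 0#) → eval F f x * eval F g x ≈ 0#
      fg≈0 x ¬[x∈T∧gx≉0] with ∈T? x | eval F g x ≟ 0#
      ... | no x∉T | _ = trans (*-congʳ (f≈0-off-T x x∉T)) (zeroˡ _)
      ... | yes _ | yes gx≈0 = trans (*-congˡ gx≈0) (zeroʳ _)
      ... | yes x∈T | no gx≉0 = ⊥-elim (¬[x∈T∧gx≉0] (x∈T , gx≉0))

open import Data.Nat using (ℕ; _+_; _*_; _∸_; _≤_)

corollary4p6 : {c ℓ : Level} (F : FiniteField c ℓ) (n : ℕ) (T : Subset F n) (r : ℕ)
    → ∃ (λ t → Subset._∈T T t)
    → AlgComplexity F T r
    → (f : Poly F n) (d : ℕ) → HasDeg F f d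
    → (∀ x → ¬ Subset._∈T T x → FiniteField._≈_ F (eval F f x) (FiniteField.0# F))
    → (∀ x → Subset._∈T T x → ¬ FiniteField._≈_ F (eval F f x) (FiniteField.0# F))
    → n * (FiniteField.q F ∸ 1) ≤ d + r
corollary4p6 F n T r T≢∅ a[T]≡r f d (f≤d , _) f≈0-off-T f≉0-on-T
  with d + r <? n * (FiniteField.q F ∸ 1)
... | no d+r≮n[q-1] = ℕ.≮⇒≥ d+r≮n[q-1]
... | yes d+r<n[q-1] =
  let g , g≤r , nonzeroIn≡1 = ∃-nonzeroIn≡1 F T T≢∅ a[T]≡r
  in ⊥-elim (∑ⁿ-eval*eval≉0 F T f g f≈0-off-T f≉0-on-T nonzeroIn≡1
                (∑ⁿ-eval*eval≈0 F n f g d r f≤d g≤r d+r<n[q-1]))
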